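{- Let $\mathcal{G}=(G,\mathcal{T},\mathcal{P})$ be a directed parametric graph template with nonnegative edge weights, and let $s,t$ be vertices belonging to the root template. Then there is a minimum $s$-$t$ cut of the instantiation of $\mathcal{G}$ in which, for every vertex $v$ of the template graph, all instances of $v$ are on the same side of the cut.
   Context: A parametric graph template $\mathcal{G}=(G,\mathcal{T},\mathcal{P})$ consists of a directed template graph $G=(V,E)$ with nonnegative edge weights, a list of templates $T_0,\dots,T_{k-1}$ with $\emptyset\neq T_i\subseteq V$, and positive integer parameters $P_0,\dots,P_{k-1}$. For $i\neq j$, either $T_i\cap T_j=\emptyset$, $T_i\subsetneq T_j$, or $T_j\subsetneq T_i$; the root template is $T_0=V$ with $P_0=1$. Inclusion induces a rooted template tree. A vertex $v$ belongs to $T(v)$, the smallest template containing it. No skipping: for every edge $(u,v)$ with $T(u)\neq T(v)$, one of $T(u),T(v)$ is the parent of the other. The instantiation: while more than one template remains, pick a leaf template $T_i\neq T_0$; replace each $v\in T_i$ (in $V$ and every template containing it) by $P_i$ copies $v_1,\dots,v_{P_i}$ (instances of $v$); replace each edge $(u,v)$ with both endpoints in $T_i$ by $(u_j,v_j)$, each edge $(u,v)$ with only $u\in T_i$ by $(u_j,v)$, and symmetrically, $j=1,\dots,P_i$, copies keeping the weight; delete $T_i,P_i$. Instances are transitive; a vertex belonging to the root template has exactly one instance (itself). An $s$-$t$ cut is a partition of the vertices into a side containing $s$ and a side containing $t$; its value is the total weight of edges from the $s$-side to the $t$-side.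
   Formalization: The edge weights of the template graph are nonnegative rationals. -}

module Defs where

open import Data.Nat using (ℕ; zero; suc; _≤_)
open import Data.Fin using (Fin; zero; suc)
open import Data.Fin.Subset using (Subset; _∈_; _⊆_; _⊂_; _∩_; Nonempty; Empty) renaming (⊤ to Full)
open import Data.Bool using (Bool; true; false; _∨_)
open import Data.Unit using (⊤; tt)
open import Data.Product using (Σ; _×_; _,_; ∃)
open import Data.Sum using (_⊎_)
open import Data.List using (List; []; _∷_; map; concatMap; allFin; foldr)
open import Data.List.Membership.Propositional renaming (_∈_ to _∈ₗ_)
open import Data.Vec using (lookup)
open import Data.Rational using (ℚ; 0ℚ; _+_) renaming (_≤_ to _≤ℚ_)
open import Relation.Binary.PropositionalEquality using (_≡_; _≢_)

-- Vertices of the template graph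
-- are Fin n; the templates are T₀ … T_{k-1} with k = suc k' (so that
-- the root template T₀ = T zero exists); edges form a list (multi-edges
-- allowed) of triples (u , v , weight).

record PGT (n : ℕ) : Set where
  field
    k' : ℕ
    E  : List (Fin n × Fin n × ℚ)
    T  : Fin (suc k') → Subset n
    P  : Fin (suc k') → ℕ

module _ {n : ℕ} (𝒢 : PGT n) where
  open PGT 𝒢

  IsSmallest : Fin n → Fin (suc k') → Set
  IsSmallest v i = v ∈ T i × (∀ j → v ∈ T j → T i ⊆ T j)

  IsParent : Fin (suc k') → Fin (suc k') → Set
  IsParent j i = T i ⊂ T j × (∀ l → T i ⊂ T l → T j ⊆ T l)

  record WellFormed : Set where
    field
      weights-nonneg : ∀ {u v w} → (u , v , w) ∈ₗ E → 0ℚ ≤ℚ w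
      nonempty       : ∀ i → Nonempty (T i)
      laminar        : ∀ i j → i ≢ j →
                         Empty (T i ∩ T j) ⊎ (T i ⊂ T j ⊎ T j ⊂ T i)
      root           : T zero ≡ Full
      root-param     : P zero ≡ 1
      params-pos     : ∀ i → 1 ≤ P i
      no-skipping    : ∀ {u v w} → (u , v , w) ∈ₗ E →
                       ∀ i j → IsSmallest u i → IsSmallest v j →
                       i ≡ j ⊎ (IsParent i j ⊎ IsParent j i)

-- Instantiation (closed form of the iterative expansion).
-- An instance of a vertex v is v together with a choice of copy index
-- in Fin (P i) for every template T i that contains v.  An instance of
-- an edge (u , v) is a choice of copy index for every template that
-- contains u or v; its endpoints are the restrictions to the templates
-- containing u, resp. v.

Coord : Bool → ℕ → Set
Coord true  p = Fin p
Coord false p = ⊤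

allCoord : (b : Bool) (p : ℕ) → List (Coord b p)
allCoord true  p = allFin p
allCoord false p = tt ∷ []

Assign : (k : ℕ) → (Fin k → ℕ) → (Fin k → Bool) → Set
Assign zero    P D = ⊤
Assign (suc k) P D = Coord (D zero) (P zero) × Assign k (λ i → P (suc i)) (λ i → D (suc i))

allAssign : (k : ℕ) (P : Fin k → ℕ) (D : Fin k → Bool) → List (Assign k P D)
allAssign zero    P D = tt ∷ []
allAssign (suc k) P D =
  concatMap (λ c → map (λ r → c , r) (allAssign k (λ i → P (suc i)) (λ i → D (suc i))))
            (allCoord (D zero) (P zero))

coordˡ : (a b : Bool) (p : ℕ) → Coord (a ∨ b) p → Coord a p
coordˡ true  b     p c = c
coordˡ false b     p c = tt

coordʳ : (a b : Bool) (p : ℕ) → Coord (a ∨ b) p → Coord b p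
coordʳ true  true  p c = c
coordʳ true  false p c = tt
coordʳ false b     p c = c

restrictˡ : (k : ℕ) (P : Fin k → ℕ) (A B : Fin k → Bool) →
            Assign k P (λ i → A i ∨ B i) → Assign k P A
restrictˡ zero    P A B tt      = tt
restrictˡ (suc k) P A B (c , r) =
  coordˡ (A zero) (B zero) (P zero) c ,
  restrictˡ k (λ i → P (suc i)) (λ i → A (suc i)) (λ i → B (suc i)) r

restrictʳ : (k : ℕ) (P : Fin k → ℕ) (A B : Fin k → Bool) →
            Assign k P (λ i → A i ∨ B i) → Assign k P B
restrictʳ zero    P A B tt      = tt
restrictʳ (suc k) P A B (c , r) =
  coordʳ (A zero) (B zero) (P zero) c ,
  restrictʳ k (λ i → P (suc i)) (λ i → A (suc i)) (λ i → B (suc i)) r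

sumℚ : List ℚ → ℚ
sumℚ = foldr _+_ 0ℚ

module _ {n : ℕ} (𝒢 : PGT n) where
  open PGT 𝒢

  mem : Fin n → Fin (suc k') → Bool
  mem v i = lookup (T i) v

  Instance : Fin n → Set
  Instance v = Assign (suc k') P (mem v)

  EdgeInstance : Fin n → Fin n → Set
  EdgeInstance u v = Assign (suc k') P (λ i → mem u i ∨ mem v i)

  src : ∀ {u v} → EdgeInstance u v → Instance u
  src {u} {v} = restrictˡ (suc k') P (mem u) (mem v)

  tgt : ∀ {u v} → EdgeInstance u v → Instance v
  tgt {u} {v} = restrictʳ (suc k') P (mem u) (mem v)

  -- a partition of the instantiated vertex set: true = s-side, false = t-side
  Cut : Set
  Cut = (v : Fin n) → Instance v → Bool

  IsSTCut : Fin n → Fin n → Cut → Set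
  IsSTCut s t S = (∀ a → S s a ≡ true) × (∀ a → S t a ≡ false)

  crosses : Bool → Bool → ℚ → ℚ
  crosses true false w = w
  crosses _    _     w = 0ℚ

  cutValue : Cut → ℚ
  cutValue S = sumℚ (map edgeVal E)
    where
    edgeVal : Fin n × Fin n × ℚ → ℚ
    edgeVal (u , v , w) =
      sumℚ (map (λ e → crosses (S u (src e)) (S v (tgt e)) w)
                (allAssign (suc k') P (λ i → mem u i ∨ mem v i)))

  IsMinSTCut : Fin n → Fin n → Cut → Set
  IsMinSTCut s t S = IsSTCut s t S × (∀ S' → IsSTCut s t S' → cutValue S ≤ℚ cutValue S')

{-# OPTIONS --safe #-}
module Submission where

-- Fix a copy index for every template at once (a choice σ) and move every instance of v to the
-- side of the instance of v that σ selects. For each edge, the pair of endpoint instances selected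
-- by σ runs over all instances of that edge equally often, so the collapsed cut values, summed over
-- all choices, add up to (number of choices) × (value of the original cut). Hence some collapsed
-- cut is no larger than the original one. Collapsed cuts are given by subsets of the template
-- vertices, and a minimum over the finitely many subsets separating s from t is a minimum s-t cut.

open import Defs
open import Algebra.Bundles using (CommutativeMonoid)
open import Data.Bool using (Bool; true; false; not; _∨_)
open import Data.Fin using (Fin; zero; suc)
open import Data.Fin.Subset using (Subset) renaming (⊥ to ∅)
open import Data.List using (List; []; _∷_; map; concatMap; foldr; length; _++_; allFin)
open import Data.List.Properties using (map-∘; length-map; length-++; length-tabulate)
open import Data.List.Membership.Propositional using () renaming (_∈_ to _∈ₗ_)
open import Data.List.Membership.Propositional.Properties using (∈-map⁺; ∈-++⁺ˡ; ∈-++⁺ʳ)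
open import Data.List.Relation.Unary.Any using (here; any?; satisfied)
open import Data.List.Relation.Unary.All as All using (All; []; _∷_)
open import Data.List.Relation.Unary.All.Properties using (¬Any⇒All¬)
open import Data.Nat as ℕ using (ℕ; zero; suc; _+_; _*_; z≤n; s≤s)
open import Data.Nat.Properties using (*-identityʳ; +-identityʳ; *-comm; *-mono-≤; *-commutativeSemigroup)
open import Data.Product using (Σ; _×_; _,_; ∃)
open import Data.Rational using (ℚ; _≤_; _<_; _≤?_)
open import Data.Rational.Properties
  using (+-0-commutativeMonoid; ≤-decTotalOrder; ≤-refl; ≤-trans; ≤-reflexive; <⇒≤; ≰⇒>;
         <-≤-trans; <-irrefl; +-mono-≤; +-mono-<-≤)
open import Data.Unit using (tt)
open import Data.Vec using ([]; _∷_; lookup; tabulate; _[_]≔_)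
open import Data.Vec.Properties using (lookup∘update; lookup∘update′; []≔-lookup; lookup∘tabulate)
open import Function using (_∘_; id)
open import Relation.Binary.Bundles using (TotalOrder; DecTotalOrder)
open import Relation.Binary.PropositionalEquality
  using (_≡_; _≢_; refl; sym; trans; cong; cong₂; subst; module ≡-Reasoning)
open import Relation.Nullary using (yes; no; contradiction)
open import Algebra.Properties.CommutativeSemigroup *-commutativeSemigroup using ()
  renaming (interchange to *-interchange)

module ListSum {c ℓ} (M : CommutativeMonoid c ℓ) where
  open CommutativeMonoid M renaming (Carrier to A) hiding (refl; sym; trans; reflexive)
  private module ≈ = CommutativeMonoid M using (refl; sym; trans; reflexive)
  open import Algebra.Properties.CommutativeMonoid.Mult M public using () renaming (_×_ to _·_)
  open import Algebra.Properties.CommutativeMonoid.Mult M using (×-distrib-+)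
  open import Algebra.Properties.CommutativeSemigroup commutativeSemigroup using (interchange)

  ∑ : {X : Set} → List X → (X → A) → A
  ∑ xs f = foldr _∙_ ε (map f xs)

  ∑-cong : {X : Set} (xs : List X) {f g : X → A} → (∀ x → f x ≈ g x) → ∑ xs f ≈ ∑ xs g
  ∑-cong []       f≈g = ≈.refl
  ∑-cong (x ∷ xs) f≈g = ∙-cong (f≈g x) (∑-cong xs f≈g)

  ∑-map : {X Y : Set} (g : X → Y) (xs : List X) (h : Y → A) → ∑ (map g xs) h ≡ ∑ xs (h ∘ g)
  ∑-map g xs h = cong (foldr _∙_ ε) (sym (map-∘ xs))

  ∑-++ : {X : Set} (xs ys : List X) (f : X → A) → ∑ (xs ++ ys) f ≈ ∑ xs f ∙ ∑ ys f
  ∑-++ []       ys f = ≈.sym (identityˡ _)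
  ∑-++ (x ∷ xs) ys f = ≈.trans (∙-congˡ (∑-++ xs ys f)) (≈.sym (assoc _ _ _))

  ∑-concatMap : {X Y : Set} (xs : List X) (g : X → List Y) (h : Y → A) →
                ∑ (concatMap g xs) h ≈ ∑ xs (λ x → ∑ (g x) h)
  ∑-concatMap []       g h = ≈.refl
  ∑-concatMap (x ∷ xs) g h = ≈.trans (∑-++ (g x) (concatMap g xs) h) (∙-congˡ (∑-concatMap xs g h))

  ∑-pairs : {X Y : Set} (xs : List X) (ys : List Y) (h : X × Y → A) →
            ∑ (concatMap (λ x → map (x ,_) ys) xs) h ≈ ∑ xs (λ x → ∑ ys (λ y → h (x , y)))
  ∑-pairs xs ys h =
    ≈.trans (∑-concatMap xs _ h) (∑-cong xs (λ x → ≈.reflexive (∑-map (x ,_) ys h)))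

  ∑-const : {X : Set} (xs : List X) (a : A) → ∑ xs (λ _ → a) ≈ length xs · a
  ∑-const []       a = ≈.refl
  ∑-const (x ∷ xs) a = ∙-congˡ (∑-const xs a)

  ∑-distrib-∙ : {X : Set} (xs : List X) (f g : X → A) → ∑ xs (λ x → f x ∙ g x) ≈ ∑ xs f ∙ ∑ xs g
  ∑-distrib-∙ []       f g = ≈.sym (identityˡ ε)
  ∑-distrib-∙ (x ∷ xs) f g = ≈.trans (∙-congˡ (∑-distrib-∙ xs f g)) (interchange _ _ _ _)

  ×-ε : ∀ m → m · ε ≈ ε
  ×-ε zero    = ≈.refl
  ×-ε (suc m) = ≈.trans (identityˡ _) (×-ε m)

  ×-distrib-∑ : {X : Set} (m : ℕ) (xs : List X) (f : X → A) → ∑ xs (λ x → m · f x) ≈ m · ∑ xs f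
  ×-distrib-∑ m []       f = ≈.sym (×-ε m)
  ×-distrib-∑ m (x ∷ xs) f = ≈.trans (∙-congˡ (×-distrib-∑ m xs f)) (≈.sym (×-distrib-+ _ _ m))

  ∑-comm : {X Y : Set} (xs : List X) (ys : List Y) (F : X → Y → A) →
           ∑ xs (λ x → ∑ ys (F x)) ≈ ∑ ys (λ y → ∑ xs (λ x → F x y))
  ∑-comm []       ys F = ≈.sym (≈.trans (∑-const ys ε) (×-ε (length ys)))
  ∑-comm (x ∷ xs) ys F =
    ≈.trans (∙-congˡ (∑-comm xs ys F)) (≈.sym (∑-distrib-∙ ys (F x) (λ y → ∑ xs (λ x′ → F x′ y))))

coordOf : (b : Bool) (p : ℕ) → Fin p → Coord b p
coordOf true  p c = c
coordOf false p c = tt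

restrict : (k : ℕ) (P : Fin k → ℕ) (D : Fin k → Bool) → Assign k P (λ _ → true) → Assign k P D
restrict zero    P D tt      = tt
restrict (suc k) P D (c , r) =
  coordOf (D zero) (P zero) c , restrict k (λ i → P (suc i)) (λ i → D (suc i)) r

coordˡ-coordOf : ∀ a b p c → coordˡ a b p (coordOf (a ∨ b) p c) ≡ coordOf a p c
coordˡ-coordOf true  b p c = refl
coordˡ-coordOf false b p c = refl

coordʳ-coordOf : ∀ a b p c → coordʳ a b p (coordOf (a ∨ b) p c) ≡ coordOf b p c
coordʳ-coordOf true  true  p c = refl
coordʳ-coordOf true  false p c = refl
coordʳ-coordOf false b     p c = refl

restrictˡ-restrict : ∀ k P A B (σ : Assign k P (λ _ → true)) →
                     restrictˡ k P A B (restrict k P (λ i → A i ∨ B i) σ) ≡ restrict k P A σ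
restrictˡ-restrict zero    P A B tt      = refl
restrictˡ-restrict (suc k) P A B (c , r) =
  cong₂ _,_ (coordˡ-coordOf (A zero) (B zero) (P zero) c)
            (restrictˡ-restrict k (λ i → P (suc i)) (λ i → A (suc i)) (λ i → B (suc i)) r)

restrictʳ-restrict : ∀ k P A B (σ : Assign k P (λ _ → true)) →
                     restrictʳ k P A B (restrict k P (λ i → A i ∨ B i) σ) ≡ restrict k P B σ
restrictʳ-restrict zero    P A B tt      = refl
restrictʳ-restrict (suc k) P A B (c , r) =
  cong₂ _,_ (coordʳ-coordOf (A zero) (B zero) (P zero) c)
            (restrictʳ-restrict k (λ i → P (suc i)) (λ i → A (suc i)) (λ i → B (suc i)) r)

length-concatMap-const : {X Y : Set} {m : ℕ} (g : X → List Y) → (∀ x → length (g x) ≡ m) →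
                         ∀ xs → length (concatMap g xs) ≡ length xs * m
length-concatMap-const g |g|≡m []       = refl
length-concatMap-const g |g|≡m (x ∷ xs) =
  trans (length-++ (g x)) (cong₂ _+_ (|g|≡m x) (length-concatMap-const g |g|≡m xs))

length-allAssign-suc : ∀ k P D → length (allAssign (suc k) P D) ≡
  length (allCoord (D zero) (P zero)) * length (allAssign k (λ i → P (suc i)) (λ i → D (suc i)))
length-allAssign-suc k P D =
  length-concatMap-const (λ c → map (c ,_) rest) (λ c → length-map (c ,_) rest) (allCoord (D zero) (P zero))
  where rest = allAssign k (λ i → P (suc i)) (λ i → D (suc i))

length-allCoord-complement : ∀ b p →
  length (allCoord b p) * length (allCoord (not b) p) ≡ length (allCoord true p)
length-allCoord-complement true  p = *-identityʳ _
length-allCoord-complement false p = +-identityʳ _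

length-allAssign-complement : ∀ k P D →
  length (allAssign k P D) * length (allAssign k P (not ∘ D)) ≡ length (allAssign k P (λ _ → true))
length-allAssign-complement zero    P D = refl
length-allAssign-complement (suc k) P D = begin
  length (allAssign (suc k) P D) * length (allAssign (suc k) P (not ∘ D))
    ≡⟨ cong₂ _*_ (length-allAssign-suc k P D) (length-allAssign-suc k P (not ∘ D)) ⟩
  (c * r) * (c̄ * r̄)
    ≡⟨ *-interchange c r c̄ r̄ ⟩
  (c * c̄) * (r * r̄)
    ≡⟨ cong₂ _*_ (length-allCoord-complement b p) (length-allAssign-complement k P′ D′) ⟩
  length (allCoord true p) * length (allAssign k P′ (λ _ → true))
    ≡⟨ sym (length-allAssign-suc k P (λ _ → true)) ⟩
  length (allAssign (suc k) P (λ _ → true)) ∎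
  where
  open ≡-Reasoning
  b = D zero
  p = P zero
  P′ = λ i → P (suc i)
  D′ = λ i → D (suc i)
  c = length (allCoord b p)
  c̄ = length (allCoord (not b) p)
  r = length (allAssign k P′ D′)
  r̄ = length (allAssign k P′ (not ∘ D′))

0<length-allAssign : ∀ k P → (∀ i → 0 ℕ.< P i) → 0 ℕ.< length (allAssign k P (λ _ → true))
0<length-allAssign zero    P P>0 = s≤s z≤n
0<length-allAssign (suc k) P P>0 =
  subst (0 ℕ.<_) (sym (length-allAssign-suc k P (λ _ → true)))
        (*-mono-≤ (subst (0 ℕ.<_) (sym (length-tabulate id)) (P>0 zero))
                  (0<length-allAssign k (λ i → P (suc i)) (λ i → P>0 (suc i))))

module _ {c ℓ} (M : CommutativeMonoid c ℓ) where
  open CommutativeMonoid M renaming (Carrier to A) hiding (refl; sym; trans; reflexive)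
  private module ≈ = CommutativeMonoid M using (refl; sym; trans; reflexive)
  open ListSum M
  open import Algebra.Properties.CommutativeMonoid.Mult M using (×-congʳ; ×-congˡ; ×-homo-1; ×-assocˡ)
  open import Relation.Binary.Reasoning.Setoid setoid

  ∑-coordOf : ∀ b p (G : Coord b p → A) →
              ∑ (allFin p) (G ∘ coordOf b p) ≈ length (allCoord (not b) p) · ∑ (allCoord b p) G
  ∑-coordOf true  p G = ≈.sym (×-homo-1 _)
  ∑-coordOf false p G =
    ≈.trans (∑-const (allFin p) (G tt)) (×-congʳ (length (allFin p)) (≈.sym (identityʳ (G tt))))

  ∑-restrict : ∀ k P D (h : Assign k P D → A) →
               ∑ (allAssign k P (λ _ → true)) (h ∘ restrict k P D) ≈
               length (allAssign k P (not ∘ D)) · ∑ (allAssign k P D) h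
  ∑-restrict zero    P D h = ≈.sym (×-homo-1 _)
  ∑-restrict (suc k) P D h = begin
    ∑ (allAssign (suc k) P (λ _ → true)) (h ∘ restrict (suc k) P D)
      ≈⟨ ∑-pairs (allFin p) (allAssign k P′ (λ _ → true)) _ ⟩
    ∑ (allFin p) (λ c → ∑ (allAssign k P′ (λ _ → true)) (λ r → h (coordOf b p c , restrict k P′ D′ r)))
      ≈⟨ ∑-cong (allFin p) (λ c → ∑-restrict k P′ D′ (λ r → h (coordOf b p c , r))) ⟩
    ∑ (allFin p) (λ c → L′ · G (coordOf b p c))
      ≈⟨ ×-distrib-∑ L′ (allFin p) (G ∘ coordOf b p) ⟩
    L′ · ∑ (allFin p) (G ∘ coordOf b p)
      ≈⟨ ×-congʳ L′ (∑-coordOf b p G) ⟩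
    L′ · (length (allCoord (not b) p) · ∑ (allCoord b p) G)
      ≈⟨ ×-assocˡ _ L′ _ ⟩
    (L′ * length (allCoord (not b) p)) · ∑ (allCoord b p) G
      ≈⟨ ×-congˡ {x = ∑ (allCoord b p) G} (trans (*-comm L′ _) (sym (length-allAssign-suc k P (not ∘ D)))) ⟩
    L · ∑ (allCoord b p) G
      ≈⟨ ×-congʳ L (≈.sym (∑-pairs (allCoord b p) (allAssign k P′ D′) h)) ⟩
    L · ∑ (allAssign (suc k) P D) h ∎
    where
    b = D zero
    p = P zero
    P′ = λ i → P (suc i)
    D′ = λ i → D (suc i)
    L = length (allAssign (suc k) P (not ∘ D))
    L′ = length (allAssign k P′ (not ∘ D′))
    G : Coord b p → A
    G x = ∑ (allAssign k P′ D′) (λ r → h (x , r))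

open ListSum +-0-commutativeMonoid
open import Algebra.Properties.CommutativeMonoid.Mult +-0-commutativeMonoid using (×-assocˡ)

∑-mono-≤ : {X : Set} (xs : List X) {f g : X → ℚ} → All (λ x → f x ≤ g x) xs → ∑ xs f ≤ ∑ xs g
∑-mono-≤ []       []             = ≤-refl
∑-mono-≤ (x ∷ xs) (fx≤gx ∷ f≤g) = +-mono-≤ fx≤gx (∑-mono-≤ xs f≤g)

∑-mono-< : {X : Set} (x : X) (xs : List X) {f g : X → ℚ} →
           All (λ y → f y < g y) (x ∷ xs) → ∑ (x ∷ xs) f < ∑ (x ∷ xs) g
∑-mono-< x xs (fx<gx ∷ f<g) = +-mono-<-≤ fx<gx (∑-mono-≤ xs (All.map <⇒≤ f<g))

∑≤length·⇒∃≤ : {X : Set} (xs : List X) (f : X → ℚ) {c : ℚ} →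
               0 ℕ.< length xs → ∑ xs f ≤ length xs · c → ∃ λ x → f x ≤ c
∑≤length·⇒∃≤ (x ∷ xs) f {c} _ ∑f≤ with any? (λ y → f y ≤? c) (x ∷ xs)
... | yes ∃f≤c = satisfied ∃f≤c
... | no ∄f≤c  = contradiction (<-≤-trans ∑c<∑f ∑f≤∑c) (<-irrefl refl)
  where
  ∑c<∑f : ∑ (x ∷ xs) (λ _ → c) < ∑ (x ∷ xs) f
  ∑c<∑f = ∑-mono-< x xs (All.map ≰⇒> (¬Any⇒All¬ (x ∷ xs) ∄f≤c))
  ∑f≤∑c : ∑ (x ∷ xs) f ≤ ∑ (x ∷ xs) (λ _ → c)
  ∑f≤∑c = ≤-trans ∑f≤ (≤-reflexive (sym (∑-const (x ∷ xs) c)))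

allSubsets : ∀ n → List (Subset n)
allSubsets zero    = [] ∷ []
allSubsets (suc n) = map (true ∷_) (allSubsets n) ++ map (false ∷_) (allSubsets n)

∈-allSubsets : ∀ {n} (p : Subset n) → p ∈ₗ allSubsets n
∈-allSubsets []          = here refl
∈-allSubsets (true ∷ p)  = ∈-++⁺ˡ (∈-map⁺ (true ∷_) (∈-allSubsets p))
∈-allSubsets (false ∷ p) = ∈-++⁺ʳ (map (true ∷_) (allSubsets _)) (∈-map⁺ (false ∷_) (∈-allSubsets p))

module _ {n : ℕ} {s t : Fin n} (s≢t : s ≢ t) where

  separate : Subset n → Subset n
  separate p = (p [ s ]≔ true) [ t ]≔ false

  separate-s : ∀ p → lookup (separate p) s ≡ true
  separate-s p = trans (lookup∘update′ s≢t (p [ s ]≔ true) false) (lookup∘update s p true)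

  separate-t : ∀ p → lookup (separate p) t ≡ false
  separate-t p = lookup∘update t (p [ s ]≔ true) false

  separate-id : ∀ {p} → lookup p s ≡ true → lookup p t ≡ false → separate p ≡ p
  separate-id {p} p[s] p[t] = begin
    (p [ s ]≔ true) [ t ]≔ false
      ≡⟨ cong₂ (λ a b → (p [ s ]≔ a) [ t ]≔ b) (sym p[s]) (sym p[t]) ⟩
    (p [ s ]≔ lookup p s) [ t ]≔ lookup p t
      ≡⟨ cong (_[ t ]≔ lookup p t) ([]≔-lookup p s) ⟩
    p [ t ]≔ lookup p t
      ≡⟨ []≔-lookup p t ⟩
    p ∎
    where open ≡-Reasoning

  module _ {a ℓ₁ ℓ₂} (O : TotalOrder a ℓ₁ ℓ₂) where
    open TotalOrder O renaming (Carrier to B; _≤_ to _≤ᴼ_)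
    open import Data.List.Extrema O using (argmin; f[argmin]≤f[xs])

    ∃-minimal-separating : (f : Subset n → B) →
      ∃ λ m → lookup m s ≡ true × lookup m t ≡ false ×
              (∀ p → lookup p s ≡ true → lookup p t ≡ false → f m ≤ᴼ f p)
    ∃-minimal-separating f = separate m₀ , separate-s m₀ , separate-t m₀ , m-minimal
      where
      m₀ = argmin (f ∘ separate) ∅ (allSubsets n)
      m-minimal : ∀ p → lookup p s ≡ true → lookup p t ≡ false → f (separate m₀) ≤ᴼ f p
      m-minimal p p[s] p[t] =
        subst (λ q → f (separate m₀) ≤ᴼ f q) (separate-id p[s] p[t])
              (All.lookup (f[argmin]≤f[xs] ∅ (allSubsets n)) (∈-allSubsets p))

module _ {n : ℕ} (𝒢 : PGT n) where
  open PGT 𝒢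

  Choice : Set
  Choice = Assign (suc k') P (λ _ → true)

  choices : List Choice
  choices = allAssign (suc k') P (λ _ → true)

  collapse : Cut 𝒢 → Choice → Cut 𝒢
  collapse S σ v _ = S v (restrict (suc k') P (mem 𝒢 v) σ)

  uniformCut : Subset n → Cut 𝒢
  uniformCut p v _ = lookup p v

  edgeInstances : (u v : Fin n) → List (EdgeInstance 𝒢 u v)
  edgeInstances u v = allAssign (suc k') P (λ i → mem 𝒢 u i ∨ mem 𝒢 v i)

  -- cutValue 𝒢 S is definitionally ∑ E (edgeValue S).
  edgeValue : Cut 𝒢 → Fin n × Fin n × ℚ → ℚ
  edgeValue S (u , v , w) = ∑ (edgeInstances u v) (λ e → crosses 𝒢 (S u (src 𝒢 e)) (S v (tgt 𝒢 e)) w)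

  edgeValue-cong : ∀ {S S′} → (∀ v a → S v a ≡ S′ v a) → ∀ e → edgeValue S e ≡ edgeValue S′ e
  edgeValue-cong S≗S′ (u , v , w) = ∑-cong (edgeInstances u v)
    (λ e → cong₂ (λ x y → crosses 𝒢 x y w) (S≗S′ u (src 𝒢 e)) (S≗S′ v (tgt 𝒢 e)))

  cutValue-cong : ∀ {S S′} → (∀ v a → S v a ≡ S′ v a) → cutValue 𝒢 S ≡ cutValue 𝒢 S′
  cutValue-cong S≗S′ = ∑-cong E (edgeValue-cong S≗S′)

  ∑-edgeValue-collapse : ∀ S e →
    ∑ choices (λ σ → edgeValue (collapse S σ) e) ≡ length choices · edgeValue S e
  ∑-edgeValue-collapse S (u , v , w) = begin
    ∑ choices (λ σ → ∑ edges (λ _ → crossingAt σ))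
      ≡⟨ ∑-cong choices (λ σ → trans (∑-const edges (crossingAt σ))
                                      (cong (length edges ·_) (crossingAt-restrict σ))) ⟩
    ∑ choices (λ σ → length edges · crossing (restrict K P D σ))
      ≡⟨ ×-distrib-∑ (length edges) choices (crossing ∘ restrict K P D) ⟩
    length edges · ∑ choices (crossing ∘ restrict K P D)
      ≡⟨ cong (length edges ·_) (∑-restrict +-0-commutativeMonoid K P D crossing) ⟩
    length edges · (length (allAssign K P (not ∘ D)) · edgeValue S (u , v , w))
      ≡⟨ ×-assocˡ _ (length edges) _ ⟩
    (length edges * length (allAssign K P (not ∘ D))) · edgeValue S (u , v , w)
      ≡⟨ cong (_· edgeValue S (u , v , w)) (length-allAssign-complement K P D) ⟩
    length choices · edgeValue S (u , v , w) ∎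
    where
    open ≡-Reasoning
    K = suc k'
    D = λ i → mem 𝒢 u i ∨ mem 𝒢 v i
    edges = edgeInstances u v
    crossing : EdgeInstance 𝒢 u v → ℚ
    crossing e = crosses 𝒢 (S u (src 𝒢 e)) (S v (tgt 𝒢 e)) w
    crossingAt : Choice → ℚ
    crossingAt σ = crosses 𝒢 (S u (restrict K P (mem 𝒢 u) σ)) (S v (restrict K P (mem 𝒢 v) σ)) w
    crossingAt-restrict : ∀ σ → crossingAt σ ≡ crossing (restrict K P D σ)
    crossingAt-restrict σ = sym (cong₂ (λ a b → crosses 𝒢 (S u a) (S v b) w)
      (restrictˡ-restrict K P (mem 𝒢 u) (mem 𝒢 v) σ) (restrictʳ-restrict K P (mem 𝒢 u) (mem 𝒢 v) σ))

  ∑-cutValue-collapse : ∀ S → ∑ choices (cutValue 𝒢 ∘ collapse S) ≡ length choices · cutValue 𝒢 S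
  ∑-cutValue-collapse S = begin
    ∑ choices (λ σ → ∑ E (edgeValue (collapse S σ)))
      ≡⟨ ∑-comm choices E _ ⟩
    ∑ E (λ e → ∑ choices (λ σ → edgeValue (collapse S σ) e))
      ≡⟨ ∑-cong E (∑-edgeValue-collapse S) ⟩
    ∑ E (λ e → length choices · edgeValue S e)
      ≡⟨ ×-distrib-∑ (length choices) E (edgeValue S) ⟩
    length choices · cutValue 𝒢 S ∎
    where open ≡-Reasoning

  collapse-≤ : (∀ i → 0 ℕ.< P i) → ∀ S → ∃ λ σ → cutValue 𝒢 (collapse S σ) ≤ cutValue 𝒢 S
  collapse-≤ P>0 S = ∑≤length·⇒∃≤ choices (cutValue 𝒢 ∘ collapse S)
    (0<length-allAssign (suc k') P P>0) (≤-reflexive (∑-cutValue-collapse S))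

  uniform-≤-STCut : (∀ i → 0 ℕ.< P i) → ∀ {s t} S → IsSTCut 𝒢 s t S →
    ∃ λ p → lookup p s ≡ true × lookup p t ≡ false × cutValue 𝒢 (uniformCut p) ≤ cutValue 𝒢 S
  uniform-≤-STCut P>0 {s} {t} S (S[s] , S[t]) with collapse-≤ P>0 S
  ... | σ , collapse≤S =
    tabulate side , trans (lookup∘tabulate side s) (S[s] _) , trans (lookup∘tabulate side t) (S[t] _) ,
    ≤-trans (≤-reflexive (cutValue-cong (λ v _ → lookup∘tabulate side v))) collapse≤S
    where
    side : Fin n → Bool
    side v = S v (restrict (suc k') P (mem 𝒢 v) σ)

lemma2 : {n : ℕ} (𝒢 : PGT n) → WellFormed 𝒢 →
    (s t : Fin n) → s ≢ t →
    IsSmallest 𝒢 s zero → IsSmallest 𝒢 t zero →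
    Σ (Cut 𝒢) (λ S → IsMinSTCut 𝒢 s t S ×
    (∀ v (a b : Instance 𝒢 v) → S v a ≡ S v b))
lemma2 𝒢 wf s t s≢t _ _
  with ∃-minimal-separating s≢t (DecTotalOrder.totalOrder ≤-decTotalOrder) (cutValue 𝒢 ∘ uniformCut 𝒢)
... | m , m[s] , m[t] , m-minimal =
  uniformCut 𝒢 m , (((λ _ → m[s]) , (λ _ → m[t])) , minimal) , (λ _ _ _ → refl)
  where
  minimal : ∀ S → IsSTCut 𝒢 s t S → cutValue 𝒢 (uniformCut 𝒢 m) ≤ cutValue 𝒢 S
  minimal S S-st with uniform-≤-STCut 𝒢 (WellFormed.params-pos wf) S S-st
  ... | p , p[s] , p[t] , p≤S = ≤-trans (m-minimal p p[s] p[t]) p≤S
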